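{- Let $G,H$ be finite simple graphs, $\tau$ a linear ordering of $V(G\Box H)$, and $\mathcal{C}$ a proper vertex coloring of $G\Box H$ using colors $1,\ldots,k$. Let $S\subseteq V(G\Box H)$ be any subset that intersects every $(\mathcal{C},\tau)$-descent. Then $S$, with the coloring inherited from $\mathcal{C}$, is a $k$-greedy defining set of $(G\Box H,\tau,\mathcal{C})$.
   Context: $G\Box H$ is the Cartesian product: vertex set $V(G)\times V(H)$, with $(u,v)\sim(u',v')$ iff either $u=u'$ and $vv'\in E(H)$, or $uu'\in E(G)$ and $v=v'$. Descent: for colors $1\le x<y\le k$ and a vertex $v$ with $\mathcal{C}(v)=y$, let $N$ be the set of neighbors of $v$ of color $x$; $\{v\}\cup N$ is a $(\mathcal{C},\tau)$-descent if every $u\in N$ has $\tau(u)>\tau(v)$ (if $N=\emptyset$, $\{v\}$ is a descent). First-Fit coloring of $(G\Box H,\tau)$ subject to a pre-coloring $\mathcal{C}(S)$ of $S$: the vertices of $S$ keep their fixed colors, and the vertices not in $S$ are scanned in the order $\tau$, each receiving the smallest positive integer not used on its already colored neighbors (vertices of $S$ count as colored from the start). $S$ is a $k$-greedy defining set ($k$-GDS) of $(G\Box H,\tau,\mathcal{C})$ if the First-Fit coloring of $(G\Box H,\tau)$ subject to the restriction $\mathcal{C}(S)$ equals $\mathcal{C}$. -}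

module Defs where

open import Data.Nat using (ℕ; zero; suc; _*_; _<_; _≤_)
open import Data.Nat using (_≡ᵇ_)
open import Data.Bool using (Bool; true; false; _∧_; _∨_; if_then_else_)
open import Data.Fin using (Fin; toℕ)
open import Data.Fin.Properties using () renaming (_≟_ to _≟ᶠ_)
open import Data.Product using (Σ; ∃; _×_; _,_; proj₁; proj₂)
open import Data.Sum using (_⊎_)
open import Data.Maybe using (Maybe; just; nothing; fromMaybe)
open import Data.List using (List; []; _∷_; map; length; allFin; cartesianProduct)
open import Data.List.Base using (mapMaybe)
open import Data.Bool.ListAction using (any)
open import Relation.Nullary.Decidable using (⌊_⌋)
open import Relation.Binary.PropositionalEquality using (_≡_)
open import Function.Bundles using (_↔_; Inverse)

record SimpleGraph (n : ℕ) : Set where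
  field
    Adj    : Fin n → Fin n → Bool
    sym    : ∀ i j → Adj i j ≡ Adj j i
    irrefl : ∀ i → Adj i i ≡ false
open SimpleGraph public

V□ : ℕ → ℕ → Set
V□ n m = Fin n × Fin m

_==ᶠ_ : ∀ {n} → Fin n → Fin n → Bool
i ==ᶠ j = ⌊ i ≟ᶠ j ⌋

Adj□ : ∀ {n m} → SimpleGraph n → SimpleGraph m → V□ n m → V□ n m → Bool
Adj□ G H (u , v) (u' , v') =
  ((u ==ᶠ u') ∧ Adj H v v') ∨ (Adj G u u' ∧ (v ==ᶠ v'))

_==□_ : ∀ {n m} → V□ n m → V□ n m → Bool
(u , v) ==□ (u' , v') = (u ==ᶠ u') ∧ (v ==ᶠ v')

allV□ : ∀ n m → List (V□ n m)
allV□ n m = cartesianProduct (allFin n) (allFin m)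

Ordering : ℕ → ℕ → Set
Ordering n m = V□ n m ↔ Fin (n * m)

pos : ∀ {n m} → Ordering n m → V□ n m → ℕ
pos τ w = toℕ (Inverse.to τ w)

IsProperColoring : ∀ {n m} → SimpleGraph n → SimpleGraph m → ℕ →
                   (V□ n m → ℕ) → Set
IsProperColoring G H k C =
  (∀ w → 1 ≤ C w × C w ≤ k) ×
  (∀ w w' → Adj□ G H w w' ≡ true → C w ≡ C w' → Data.Empty.⊥)
  where import Data.Empty

elemᵇ : ℕ → List ℕ → Bool
elemᵇ c ls = any (λ d → c ≡ᵇ d) ls

mexFrom : ℕ → ℕ → List ℕ → ℕ
mexFrom c zero    ls = c
mexFrom c (suc f) ls = if elemᵇ c ls then mexFrom (suc c) f ls else c

mex⁺ : List ℕ → ℕ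
mex⁺ ls = mexFrom 1 (length ls) ls

module FirstFit {n m : ℕ} (G : SimpleGraph n) (H : SimpleGraph m)
                (τ : Ordering n m) (C : V□ n m → ℕ) (S : V□ n m → Bool) where

  Partial : Set
  Partial = V□ n m → Maybe ℕ

  initial : Partial
  initial w = if S w then just (C w) else nothing

  usedColors : Partial → V□ n m → List ℕ
  usedColors p w =
    mapMaybe (λ u → if Adj□ G H w u then p u else nothing) (allV□ n m)

  assign : Partial → V□ n m → ℕ → Partial
  assign p w c u = if u ==□ w then just c else p u

  step : Partial → V□ n m → Partial
  step p w = if S w then p else assign p w (mex⁺ (usedColors p w))

  run : List (V□ n m) → Partial → Partial
  run []       p = p
  run (w ∷ ws) p = run ws (step p w)

  order : List (V□ n m)
  order = map (Inverse.from τ) (allFin (n * m))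

  -- the resulting First-Fit colouring (every vertex is coloured at the end)
  coloring : V□ n m → ℕ
  coloring w = fromMaybe 0 (run order initial w)

-- S is a k-greedy defining set of (G □ H, τ, C): First-Fit subject to C(S)
-- reproduces C.  (k is the palette bound of C, carried as in the paper.)
IsKGDS : ∀ {n m} → SimpleGraph n → SimpleGraph m → ℕ → Ordering n m →
         (V□ n m → ℕ) → (V□ n m → Bool) → Set
IsKGDS G H k τ C S =
  (∀ w → FirstFit.coloring G H τ C S w ≡ C w)

-- (C,τ)-descent determined by colours x < y and a vertex v of colour y:
-- the set {v} ∪ N, N = neighbours of v of colour x, all later than v in τ.
IsDescent : ∀ {n m} → SimpleGraph n → SimpleGraph m → ℕ → Ordering n m →
            (V□ n m → ℕ) → ℕ → ℕ → V□ n m → Set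
IsDescent G H k τ C x y v =
  1 ≤ x × x < y × y ≤ k × C v ≡ y ×
  (∀ u → Adj□ G H v u ≡ true → C u ≡ x → pos τ v < pos τ u)

InDescentSet : ∀ {n m} → SimpleGraph n → SimpleGraph m →
               (V□ n m → ℕ) → ℕ → V□ n m → V□ n m → Set
InDescentSet G H C x v w = w ≡ v ⊎ (Adj□ G H v w ≡ true × C w ≡ x)

MeetsAllDescents : ∀ {n m} → SimpleGraph n → SimpleGraph m → ℕ →
                   Ordering n m → (V□ n m → ℕ) → (V□ n m → Bool) → Set
MeetsAllDescents G H k τ C S =
  ∀ x y v → IsDescent G H k τ C x y v →
  ∃ λ w → InDescentSet G H C x v w × S w ≡ true

-- First-Fit can only give a vertex v a colour other than C v if some colour x < C v is missing
-- among v's already coloured neighbours (a repeat of C v is excluded by properness). Scanning in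
-- the order τ, the x-neighbours of v are then all still uncoloured, hence later than v, so v and
-- they form a (C,τ)-descent. That descent contains a vertex of S, yet vertices of S are
-- pre-coloured and v itself is not in S: a contradiction.
module Submission where

open import Defs hiding (sym)
open import Data.Nat using (ℕ)
open import Data.Bool using (Bool)

open import Data.Nat using (zero; suc; _+_; _<_; _≤_; z≤n; s≤s; _≡ᵇ_)
open import Data.Nat.Properties
  using (_≟_; ≡ᵇ⇒≡; ≡⇒≡ᵇ; m≤n⇒m<n∨m≡n; ≤-antisym; ≤-refl; <⇒≤; +-identityʳ; +-suc; suc-injective)
open import Data.Bool using (true; false; if_then_else_)
open import Data.Bool.Properties using (T-≡)
open import Data.Fin using (Fin; toℕ) renaming (_<_ to _<ᶠ_)
open import Data.Fin.Properties using (toℕ<n; toℕ-injective; injective⇒≤) renaming (_≟_ to _≟ᶠ_)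
open import Data.Product using (∃; _×_; _,_; proj₁; proj₂)
open import Data.Product.Properties using (≡-dec)
open import Data.Sum using (_⊎_; inj₁; inj₂)
open import Data.Maybe using (Maybe; just; nothing)
open import Data.Maybe.Properties using (just-injective)
open import Data.List using (List; []; _∷_; length; lookup; mapMaybe)
open import Data.List.Membership.Propositional using (_∈_; _∉_)
open import Data.List.Membership.Propositional.Properties
  using (∈-map⁺; ∈-allFin; ∈-cartesianProduct⁺)
open import Data.List.Membership.DecPropositional _≟_ using (_∈?_)
open import Data.List.Relation.Unary.Any using (here; there; index)
import Data.List.Relation.Unary.Any as Any
open import Data.List.Relation.Unary.Any.Properties using (lookup-index; any⁺; any⁻)
open import Data.List.Relation.Unary.All using (All)
import Data.List.Relation.Unary.All as All
open import Data.List.Relation.Unary.AllPairs using (AllPairs; []; _∷_)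
open import Data.List.Relation.Unary.AllPairs.Properties using (map⁺; tabulate⁺-<)
open import Relation.Nullary using (¬_; yes; no; contradiction)
open import Relation.Nullary.Decidable using (isYes≗does; dec-true; dec-false; decidable-stable)
open import Relation.Binary.Definitions using (DecidableEquality)
open import Relation.Binary.PropositionalEquality
open import Function using (_∘_)
open import Function.Bundles using (Inverse; Equivalence)

==ᶠ-refl : ∀ {n} (i : Fin n) → (i ==ᶠ i) ≡ true
==ᶠ-refl i = trans (isYes≗does (i ≟ᶠ i)) (dec-true (i ≟ᶠ i) refl)

==ᶠ-≢ : ∀ {n} {i j : Fin n} → i ≢ j → (i ==ᶠ j) ≡ false
==ᶠ-≢ {i = i} {j} i≢j = trans (isYes≗does (i ≟ᶠ j)) (dec-false (i ≟ᶠ j) i≢j)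

_≟□_ : ∀ {n m} → DecidableEquality (V□ n m)
_≟□_ = ≡-dec _≟ᶠ_ _≟ᶠ_

==□-refl : ∀ {n m} (w : V□ n m) → (w ==□ w) ≡ true
==□-refl (u , v) rewrite ==ᶠ-refl u | ==ᶠ-refl v = refl

==□-≢ : ∀ {n m} {w w' : V□ n m} → w ≢ w' → (w ==□ w') ≡ false
==□-≢ {w = u , v} {u' , v'} w≢w' with u ≟ᶠ u'
... | no _     = refl
... | yes refl rewrite ==ᶠ-≢ {i = v} {v'} (w≢w' ∘ cong (u ,_)) = refl

Adj□-irrefl : ∀ {n m} (G : SimpleGraph n) (H : SimpleGraph m) w → Adj□ G H w w ≡ false
Adj□-irrefl G H (u , v)
  rewrite ==ᶠ-refl u | ==ᶠ-refl v | SimpleGraph.irrefl H v | SimpleGraph.irrefl G u = refl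

∈-mapMaybe⁺ : ∀ {A B : Set} (f : A → Maybe B) {x y} xs → x ∈ xs → f x ≡ just y → y ∈ mapMaybe f xs
∈-mapMaybe⁺ f (x ∷ xs) (here refl) fx≡y rewrite fx≡y = here refl
∈-mapMaybe⁺ f (x ∷ xs) (there x∈xs) fx≡y with f x
... | just _  = there (∈-mapMaybe⁺ f xs x∈xs fx≡y)
... | nothing = ∈-mapMaybe⁺ f xs x∈xs fx≡y

∈-mapMaybe⁻ : ∀ {A B : Set} (f : A → Maybe B) {y} xs → y ∈ mapMaybe f xs → ∃ λ x → f x ≡ just y
∈-mapMaybe⁻ f (x ∷ xs) y∈ with f x in fx
∈-mapMaybe⁻ f (x ∷ xs) (here refl) | just _ = x , fx
∈-mapMaybe⁻ f (x ∷ xs) (there y∈) | just _ = ∈-mapMaybe⁻ f xs y∈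
... | nothing = ∈-mapMaybe⁻ f xs y∈

∈⇒elemᵇ : ∀ {x ls} → x ∈ ls → elemᵇ x ls ≡ true
∈⇒elemᵇ {x} x∈ls =
  Equivalence.to T-≡ (any⁺ (x ≡ᵇ_) (Any.map (λ { refl → ≡⇒≡ᵇ x x refl }) x∈ls))

elemᵇ⇒∈ : ∀ {x} ls → elemᵇ x ls ≡ true → x ∈ ls
elemᵇ⇒∈ {x} ls e = Any.map (≡ᵇ⇒≡ x _) (any⁻ (x ≡ᵇ_) ls (Equivalence.from T-≡ e))

∉⇒elemᵇ : ∀ {x} ls → x ∉ ls → elemᵇ x ls ≡ false
∉⇒elemᵇ {x} ls x∉ls with elemᵇ x ls in e
... | false = refl
... | true  = contradiction (elemᵇ⇒∈ ls e) x∉ls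

covering⇒≤length : ∀ {z} (ls : List ℕ) → (∀ (i : Fin z) → suc (toℕ i) ∈ ls) → z ≤ length ls
covering⇒≤length ls mem = injective⇒≤ {f = λ i → index (mem i)} index-injective
  where
  open ≡-Reasoning
  index-injective : ∀ {i j} → index (mem i) ≡ index (mem j) → i ≡ j
  index-injective {i} {j} eq = toℕ-injective (suc-injective (begin
    suc (toℕ i)              ≡⟨ lookup-index (mem i) ⟩
    lookup ls (index (mem i)) ≡⟨ cong (lookup ls) eq ⟩
    lookup ls (index (mem j)) ≡⟨ sym (lookup-index (mem j)) ⟩
    suc (toℕ j)              ∎))

mexFrom-≡ : ∀ fuel {c y} ls → c ≤ y → y ≤ c + fuel →
            (∀ {x} → c ≤ x → x < y → x ∈ ls) → y ∉ ls → mexFrom c fuel ls ≡ y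
mexFrom-≡ zero {c} {y} ls c≤y y≤c+0 _ _ = ≤-antisym c≤y (subst (y ≤_) (+-identityʳ c) y≤c+0)
mexFrom-≡ (suc fuel) {c} {y} ls c≤y y≤c+fuel below y∉ls with m≤n⇒m<n∨m≡n c≤y
... | inj₂ refl rewrite ∉⇒elemᵇ ls y∉ls = refl
... | inj₁ c<y rewrite ∈⇒elemᵇ (below ≤-refl c<y) =
  mexFrom-≡ fuel ls c<y (subst (y ≤_) (+-suc c fuel) y≤c+fuel) (below ∘ <⇒≤) y∉ls

-- The fuel length ls suffices since a list covering 1,…,y-1 has length at least y-1.
mex⁺-≡ : ∀ {y} ls → 1 ≤ y → (∀ {x} → 1 ≤ x → x < y → x ∈ ls) → y ∉ ls → mex⁺ ls ≡ y
mex⁺-≡ ls 1≤y@(s≤s _) below y∉ls =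
  mexFrom-≡ (length ls) ls 1≤y (s≤s (covering⇒≤length ls covered)) below y∉ls
  where
  covered : ∀ i → suc (toℕ i) ∈ ls
  covered i = below (s≤s z≤n) (s≤s (toℕ<n i))

module FirstFitProperties {n m : ℕ} (G : SimpleGraph n) (H : SimpleGraph m)
                          (τ : Ordering n m) (C : V□ n m → ℕ) (S : V□ n m → Bool) where
  open FirstFit G H τ C S

  _≺_ : V□ n m → V□ n m → Set
  v ≺ w = pos τ v < pos τ w

  Faithful : Partial → List (V□ n m) → Set
  Faithful p ws = ∀ w → p w ≡ just (C w) ⊎ (p w ≡ nothing × S w ≡ false × w ∈ ws)

  -- v is the vertex being scanned, ws the ones after it; all vertices scanned before v agree with C.
  PicksC : Set
  PicksC = ∀ {v ws p} → All (v ≺_) ws → Faithful p (v ∷ ws) → S v ≡ false →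
           mex⁺ (usedColors p v) ≡ C v

  ∈-usedColors⁺ : ∀ {p v u c} → Adj□ G H v u ≡ true → p u ≡ just c → c ∈ usedColors p v
  ∈-usedColors⁺ {p} {v} {u} adj pu =
    ∈-mapMaybe⁺ _ (allV□ n m) (∈-cartesianProduct⁺ (∈-allFin _) (∈-allFin _))
      (trans (cong (λ b → if b then p u else nothing) adj) pu)

  ∈-usedColors⁻ : ∀ {p v c} → c ∈ usedColors p v → ∃ λ u → Adj□ G H v u ≡ true × p u ≡ just c
  ∈-usedColors⁻ {p} {v} c∈ with ∈-mapMaybe⁻ _ (allV□ n m) c∈
  ... | u , pu with Adj□ G H v u in adj
  ...   | true = u , adj , pu
  ...   | false with () ← pu

  in-S⇒coloured : ∀ {p ws w} → Faithful p ws → S w ≡ true → p w ≡ just (C w)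
  in-S⇒coloured {w = w} faithful sw with faithful w
  ... | inj₁ pw = pw
  ... | inj₂ (_ , sw' , _) with () ← trans (sym sw) sw'

  faithful-tail : ∀ {p q v ws} → Faithful p (v ∷ ws) → q v ≡ just (C v) →
                  (∀ {w} → w ≢ v → q w ≡ p w) → Faithful q ws
  faithful-tail {v = v} faithful qv q≗p w with w ≟□ v
  ... | yes refl = inj₁ qv
  ... | no w≢v rewrite q≗p w≢v with faithful w
  ...   | inj₁ pw = inj₁ pw
  ...   | inj₂ (pw , sw , here w≡v) = contradiction w≡v w≢v
  ...   | inj₂ (pw , sw , there w∈ws) = inj₂ (pw , sw , w∈ws)

  assign-here : ∀ {p v c} → assign p v c v ≡ just c
  assign-here {v = v} rewrite ==□-refl v = refl

  assign-elsewhere : ∀ {p v c w} → w ≢ v → assign p v c w ≡ p w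
  assign-elsewhere w≢v rewrite ==□-≢ w≢v = refl

  step-faithful : ∀ {p v ws} → (S v ≡ false → mex⁺ (usedColors p v) ≡ C v) →
                  Faithful p (v ∷ ws) → Faithful (step p v) ws
  step-faithful {p} {v} picks faithful with S v in sv
  ... | true  = faithful-tail faithful (in-S⇒coloured faithful sv) (λ _ → refl)
  ... | false rewrite picks refl =
    faithful-tail faithful (assign-here {p}) (assign-elsewhere {p})

  run-reproduces : PicksC → ∀ {ws p} → AllPairs _≺_ ws → Faithful p ws →
                   ∀ w → run ws p w ≡ just (C w)
  run-reproduces picks [] faithful w with faithful w
  ... | inj₁ pw = pw
  ... | inj₂ (_ , _ , ())
  run-reproduces picks (later ∷ sorted) faithful =
    run-reproduces picks sorted (step-faithful (picks later faithful) faithful)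

  order-sorted : AllPairs _≺_ order
  order-sorted = map⁺ (tabulate⁺-< increasing)
    where
    increasing : ∀ {i j} → i <ᶠ j → Inverse.from τ i ≺ Inverse.from τ j
    increasing {i} {j} i<j
      rewrite Inverse.strictlyInverseˡ τ i | Inverse.strictlyInverseˡ τ j = i<j

  initial-faithful : Faithful initial order
  initial-faithful w with S w
  ... | true  = inj₁ refl
  ... | false = inj₂ (refl , refl , w∈order)
    where
    w∈order : w ∈ order
    w∈order = subst (_∈ order) (Inverse.strictlyInverseʳ τ w)
                    (∈-map⁺ (Inverse.from τ) (∈-allFin (Inverse.to τ w)))

  firstFit-reproduces : PicksC → ∀ w → coloring w ≡ C w
  firstFit-reproduces picks w
    rewrite run-reproduces picks order-sorted initial-faithful w = refl

module DescentArgument {n m : ℕ} (G : SimpleGraph n) (H : SimpleGraph m) (k : ℕ)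
                       (τ : Ordering n m) (C : V□ n m → ℕ) (S : V□ n m → Bool)
                       (proper : IsProperColoring G H k C)
                       (meets : MeetsAllDescents G H k τ C S) where
  open FirstFit G H τ C S
  open FirstFitProperties G H τ C S

  own-colour-unused : ∀ {p ws v} → Faithful p ws → C v ∉ usedColors p v
  own-colour-unused {v = v} faithful Cv∈ with ∈-usedColors⁻ Cv∈
  ... | u , adj , pu with faithful u
  ...   | inj₁ pu' = proj₂ proper v u adj (sym (just-injective (trans (sym pu') pu)))
  ...   | inj₂ (pu' , _) with () ← trans (sym pu') pu

  smaller-colours-used : ∀ {p ws v x} → All (v ≺_) ws → Faithful p (v ∷ ws) → S v ≡ false →
                         1 ≤ x → x < C v → x ∈ usedColors p v
  smaller-colours-used {p} {ws} {v} {x} later faithful sv 1≤x x<Cv =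
    decidable-stable (x ∈? usedColors p v) λ x∉ →
      descent-missed x∉ (meets x (C v) v (1≤x , x<Cv , proj₂ (proj₁ proper v) , refl , x-neighbours-later x∉))
    where
    x-neighbours-later : x ∉ usedColors p v → ∀ u → Adj□ G H v u ≡ true → C u ≡ x → v ≺ u
    x-neighbours-later x∉ u adj Cu with faithful u
    ... | inj₁ pu = contradiction (∈-usedColors⁺ adj (trans pu (cong just Cu))) x∉
    ... | inj₂ (_ , _ , here refl) with () ← trans (sym adj) (Adj□-irrefl G H v)
    ... | inj₂ (_ , _ , there u∈ws) = All.lookup later u∈ws

    descent-missed : x ∉ usedColors p v → ¬ ∃ λ w → InDescentSet G H C x v w × S w ≡ true
    descent-missed x∉ (w , inj₁ refl , sw) with () ← trans (sym sv) sw
    descent-missed x∉ (w , inj₂ (adj , Cw) , sw) =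
      x∉ (∈-usedColors⁺ adj (trans (in-S⇒coloured faithful sw) (cong just Cw)))

  picksC : PicksC
  picksC later faithful sv =
    mex⁺-≡ _ (proj₁ (proj₁ proper _)) (smaller-colours-used later faithful sv) (own-colour-unused faithful)

theorem6 : ∀ {n m} (G : SimpleGraph n) (H : SimpleGraph m) (k : ℕ)
           (τ : Ordering n m) (C : V□ n m → ℕ) (S : V□ n m → Bool) →
           IsProperColoring G H k C →
           MeetsAllDescents G H k τ C S →
           IsKGDS G H k τ C S
theorem6 G H k τ C S proper meets =
  FirstFitProperties.firstFit-reproduces G H τ C S (DescentArgument.picksC G H k τ C S proper meets)
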